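{- Let $N=(V,A,s,t,u)$ be a network with $V=\{s,v,t\}$, where every arc of the multiset $A$ goes either from $s$ to $v$ or from $v$ to $t$, with nonnegative integer capacities $u=(u_a)_{a\in A}$; let $J\subseteq A$ be the set of arcs with a maintenance job and let $T\geqslant 1$ be the number of time periods. Define $C_1^-=\sum_{a\in\delta^-(v)}u_a$, $C_1^+=\sum_{a\in\delta^+(v)}u_a$, $C_2^-=\sum_{a\in\delta^-(v)\setminus J}u_a$, $C_2^+=\sum_{a\in\delta^+(v)\setminus J}u_a$. If (i) $C_1^-\leqslant C_1^+$ and $C_2^-\leqslant C_2^+$, or (ii) $C_1^+\leqslant C_1^-$ and $C_2^+\leqslant C_2^-$, then scheduling all jobs in the same time period is optimal for the maintenance scheduling problem described in the context.
   Context: Maintenance scheduling problem: given a directed network $N=(V,A,s,t,u)$ (parallel arcs allowed, so $A$ is a multiset) with source $s$, sink $t$ and nonnegative integer capacities $u_a$, a set $J\subseteq A$ of arcs each of which must be shut down for exactly one of the time periods $[T]=\{1,\dots,T\}$, a schedule assigns to each $a\in J$ a period $\tau(a)\in[T]$. In period $i$, every arc $a\in J$ with $\tau(a)=i$ has capacity $0$, all other arcs have capacity $u_a$, and an $s$-$t$ flow (satisfying capacity constraints and flow conservation at all nodes other than $s,t$) is sent independently in each period. The total throughput is the sum over $i\in[T]$ of the net flow out of $s$ in period $i$; the problem is to choose the schedule and flows maximizing total throughput. "Scheduling all jobs in the same time period" means $\tau$ is constant on $J$. $\delta^-(v)$ and $\delta^+(v)$ denote the sets of arcs entering and leaving $v$.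 -}

module Defs where

open import Data.Nat using (ℕ; zero; suc; _+_; _≤_)
open import Data.Integer as ℤ using (ℤ; +_; _-_)
open import Data.Fin using (Fin; zero; suc; _≟_)
open import Data.Bool using (Bool; true; false; if_then_else_; _∧_; not)
open import Data.Product using (Σ; _×_)
open import Relation.Nullary using (¬_; does)
open import Relation.Binary.PropositionalEquality using (_≡_)

Σℕ : (n : ℕ) → (Fin n → ℕ) → ℕ
Σℕ zero    f = 0
Σℕ (suc n) f = f zero + Σℕ n (λ i → f (suc i))

Σℤ : (n : ℕ) → (Fin n → ℤ) → ℤ
Σℤ zero    f = + 0
Σℤ (suc n) f = f zero ℤ.+ Σℤ n (λ i → f (suc i))

-- A network N = (V, A, s, t, u): nodes Fin nV, arcs indexed by Fin m
-- (parallel arcs allowed), each arc with tail, head and capacity.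
record Network : Set where
  field
    nV   : ℕ
    m    : ℕ
    tail : Fin m → Fin nV
    head : Fin m → Fin nV
    cap  : Fin m → ℕ
    s    : Fin nV
    t    : Fin nV
open Network public

sumIn : (N : Network) → (Fin (m N) → Bool) → (Fin (m N) → ℕ) → Fin (nV N) → ℕ
sumIn N P g w = Σℕ (m N) (λ a → if does (head N a ≟ w) ∧ P a then g a else 0)

sumOut : (N : Network) → (Fin (m N) → Bool) → (Fin (m N) → ℕ) → Fin (nV N) → ℕ
sumOut N P g w = Σℕ (m N) (λ a → if does (tail N a ≟ w) ∧ P a then g a else 0)

allArcs : (N : Network) → Fin (m N) → Bool
allArcs N a = true

record IsFlow (N : Network) (c : Fin (m N) → ℕ) (f : Fin (m N) → ℕ) : Set where
  field
    capacity     : ∀ a → f a ≤ c a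
    conservation : ∀ w → ¬ w ≡ s N → ¬ w ≡ t N →
                   sumIn N (allArcs N) f w ≡ sumOut N (allArcs N) f w

value : (N : Network) → (Fin (m N) → ℕ) → ℤ
value N f = + sumOut N (allArcs N) f (s N) - + sumIn N (allArcs N) f (s N)

-- capacities in period i under schedule τ (τ only matters on J)
periodCap : (N : Network) → (J : Fin (m N) → Bool) → {T : ℕ} →
            (Fin (m N) → Fin T) → Fin T → Fin (m N) → ℕ
periodCap N J τ i a = if J a ∧ does (τ a ≟ i) then 0 else cap N a

throughput : (N : Network) → (T : ℕ) → (Fin T → Fin (m N) → ℕ) → ℤ
throughput N T F = Σℤ T (λ i → value N (F i))

Feasible : (N : Network) → (J : Fin (m N) → Bool) → (T : ℕ) →
           (Fin (m N) → Fin T) → (Fin T → Fin (m N) → ℕ) → Set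
Feasible N J T τ F = ∀ i → IsFlow N (periodCap N J τ i) (F i)

SamePeriodOptimal : (N : Network) → (J : Fin (m N) → Bool) → (T : ℕ) → Set
SamePeriodOptimal N J T =
  Σ (Fin T) λ i₀ → Σ (Fin T → Fin (m N) → ℕ) λ F₀ →
    Feasible N J T (λ _ → i₀) F₀ ×
    (∀ (τ : Fin (m N) → Fin T) (F : Fin T → Fin (m N) → ℕ) →
       Feasible N J T τ F → throughput N T F ℤ.≤ throughput N T F₀)

-- The three-node network V = {s, v, t} = {0, 1, 2}; arc a goes s→v if
-- dir a = true and v→t if dir a = false.
sN vN tN : Fin 3
sN = zero
vN = suc zero
tN = suc (suc zero)

threeNode : (m : ℕ) → (Fin m → Bool) → (Fin m → ℕ) → Network
threeNode m dir u = record
  { nV = 3 ; m = m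
  ; tail = λ a → if dir a then sN else vN
  ; head = λ a → if dir a then vN else tN
  ; cap = u ; s = sN ; t = tN }

C₁⁻ C₁⁺ : (N : Network) → Fin (nV N) → ℕ
C₁⁻ N v = sumIn  N (allArcs N) (cap N) v
C₁⁺ N v = sumOut N (allArcs N) (cap N) v

C₂⁻ C₂⁺ : (N : Network) → (Fin (m N) → Bool) → Fin (nV N) → ℕ
C₂⁻ N J v = sumIn  N (λ a → not (J a)) (cap N) v
C₂⁺ N J v = sumOut N (λ a → not (J a)) (cap N) v

module Submission where

-- In the three-node network s → v → t every unit of flow passes
-- through v, so in a period with capacities c the best throughput is
-- In c ⊓ Out c, the smaller of the capacity into v and out of v.  Hence any
-- schedule with feasible flows has total throughput at most
-- (Σᵢ In cᵢ) ⊓ (Σᵢ Out cᵢ), and both sums are the same for every schedule,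
-- because each job arc loses its capacity in exactly one period.  Scheduling
-- all jobs in period zero yields capacities (C₂⁻, C₂⁺) in period zero and
-- (C₁⁻, C₁⁺) in the later periods; under (i) or (ii) the same side is the
-- smaller one in every period, so Σᵢ (In cᵢ ⊓ Out cᵢ) equals the bound, and
-- it is attained by filling the arcs greedily in each period.

open import Defs
open import Data.Nat using (ℕ; _≤_)
open import Data.Fin using (Fin)
open import Data.Bool using (Bool)
open import Data.Product using (_×_)
open import Data.Sum using (_⊎_)

open import Data.Nat using (zero; suc; _+_; _*_; _∸_; _⊓_; z≤n; s≤s)
open import Data.Nat.Properties
  using (+-assoc; +-comm; +-identityʳ; +-cancelʳ-≡; +-mono-≤; ≤-refl; ≤-trans;
         ≤-reflexive; n≤0⇒n≡0; m≤n⇒m⊓n≡m; m≥n⇒m⊓n≡n; m⊓n≤m; m⊓n≤n; ⊓-glb;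
         m⊓n+n∸m≡n; m≤n+o⇒m∸n≤o; module ≤-Reasoning)
open import Data.Nat.Tactic.RingSolver using (solve-∀)
open import Data.Fin using (zero; suc; _≟_)
open import Data.Bool using (true; false; if_then_else_; _∧_; not)
open import Data.Product using (Σ-syntax; _,_; proj₁; proj₂)
open import Data.Sum using (inj₁; inj₂) renaming (map to map-⊎)
open import Data.Empty using (⊥-elim)
open import Data.Integer as ℤ using (+≤+)
open import Data.Vec.Functional using (_∷_)
open import Function using (_∘_)
open import Relation.Nullary using (does)
open import Relation.Binary.PropositionalEquality
  using (_≡_; refl; sym; trans; cong; cong₂; subst₂; module ≡-Reasoning)

Σ-cong : ∀ n {f g : Fin n → ℕ} → (∀ a → f a ≡ g a) → Σℕ n f ≡ Σℕ n g
Σ-cong zero    f≡g = refl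
Σ-cong (suc n) f≡g = cong₂ _+_ (f≡g zero) (Σ-cong n (f≡g ∘ suc))

Σ-mono : ∀ n {f g : Fin n → ℕ} → (∀ a → f a ≤ g a) → Σℕ n f ≤ Σℕ n g
Σ-mono zero    f≤g = z≤n
Σ-mono (suc n) f≤g = +-mono-≤ (f≤g zero) (Σ-mono n (f≤g ∘ suc))

Σ-const : ∀ n x → Σℕ n (λ _ → x) ≡ n * x
Σ-const zero    x = refl
Σ-const (suc n) x = cong (x +_) (Σ-const n x)

Σ-zero : ∀ n → Σℕ n (λ _ → 0) ≡ 0
Σ-zero zero    = refl
Σ-zero (suc n) = Σ-zero n

Σ-+ : ∀ n (f g : Fin n → ℕ) → Σℕ n (λ a → f a + g a) ≡ Σℕ n f + Σℕ n g
Σ-+ zero    f g = refl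
Σ-+ (suc n) f g = trans (cong (f zero + g zero +_) (Σ-+ n (f ∘ suc) (g ∘ suc)))
                        (interchange (f zero) (g zero) _ _)
  where
  interchange : ∀ a b c d → (a + b) + (c + d) ≡ (a + c) + (b + d)
  interchange = solve-∀

Σ-swap : ∀ n k (f : Fin n → Fin k → ℕ) →
         Σℕ n (λ i → Σℕ k (f i)) ≡ Σℕ k (λ a → Σℕ n (λ i → f i a))
Σ-swap zero    k f = sym (Σ-zero k)
Σ-swap (suc n) k f = trans (cong (Σℕ k (f zero) +_) (Σ-swap n k (f ∘ suc)))
                           (sym (Σ-+ k (f zero) _))

-- If one summand dominates the other at every index, the minimum commutes
-- with summation.  This is where hypotheses (i) and (ii) enter.
Σ-⊓ : ∀ n (x y : Fin n → ℕ) → (∀ i → x i ≤ y i) ⊎ (∀ i → y i ≤ x i) →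
      Σℕ n (λ i → x i ⊓ y i) ≡ Σℕ n x ⊓ Σℕ n y
Σ-⊓ n x y (inj₁ x≤y) =
  trans (Σ-cong n (m≤n⇒m⊓n≡m ∘ x≤y)) (sym (m≤n⇒m⊓n≡m (Σ-mono n x≤y)))
Σ-⊓ n x y (inj₂ y≤x) =
  trans (Σ-cong n (m≥n⇒m⊓n≡n ∘ y≤x)) (sym (m≥n⇒m⊓n≡n (Σ-mono n y≤x)))

Σ-hole : ∀ n (j : Fin n) x → Σℕ n (λ i → if does (j ≟ i) then 0 else x) + x ≡ n * x
Σ-hole (suc n) zero    x = trans (+-comm (Σℕ n (λ _ → x)) x) (cong (x +_) (Σ-const n x))
Σ-hole (suc n) (suc j) x = trans (+-assoc x _ x) (cong (x +_) (Σ-hole n j x))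

-- Masked sums: Σ⟨ p ⟩ g sums g over the indices selected by p.  The sums
-- sumIn/sumOut of Defs are masked sums with mask "head/tail is w, and P".

Σ⟨_⟩ : ∀ {n} → (Fin n → Bool) → (Fin n → ℕ) → ℕ
Σ⟨ p ⟩ g = Σℕ _ (λ a → if p a then g a else 0)

Σ⟨⟩-cong : ∀ {n} (p : Fin n → Bool) {f g : Fin n → ℕ} → (∀ a → f a ≡ g a) →
           Σ⟨ p ⟩ f ≡ Σ⟨ p ⟩ g
Σ⟨⟩-cong p f≡g = Σ-cong _ (λ a → cong (λ x → if p a then x else 0) (f≡g a))

Σ⟨⟩-mono : ∀ {n} (p : Fin n → Bool) {f g : Fin n → ℕ} → (∀ a → f a ≤ g a) →
           Σ⟨ p ⟩ f ≤ Σ⟨ p ⟩ g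
Σ⟨⟩-mono p f≤g = Σ-mono _ (λ a → masked (p a) (f≤g a))
  where
  masked : ∀ b {x y} → x ≤ y → (if b then x else 0) ≤ (if b then y else 0)
  masked true  x≤y = x≤y
  masked false _   = z≤n

Σ⟨⟩-swap : ∀ T {n} (p : Fin n → Bool) (g : Fin T → Fin n → ℕ) →
           Σℕ T (λ i → Σ⟨ p ⟩ (g i)) ≡ Σ⟨ p ⟩ (λ a → Σℕ T (λ i → g i a))
Σ⟨⟩-swap T {n} p g = trans (Σ-swap T n _) (Σ-cong n (λ a → pullMask (p a) a))
  where
  pullMask : ∀ b a → Σℕ T (λ i → if b then g i a else 0) ≡ (if b then Σℕ T (λ i → g i a) else 0)
  pullMask true  a = refl
  pullMask false a = Σ-zero T

-- Greedy filling: an amount d up to the total capacity of the selected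
-- indices can be spread over them within the capacities.  This realises the
-- flow values needed in each period.

Filling : ∀ {n} → (Fin n → Bool) → (Fin n → ℕ) → ℕ → Set
Filling {n} p c d = Σ[ f ∈ (Fin n → ℕ) ] (∀ a → f a ≤ c a) × Σ⟨ p ⟩ f ≡ d

fill : ∀ {n} (p : Fin n → Bool) (c : Fin n → ℕ) d → d ≤ Σ⟨ p ⟩ c → Filling p c d
fill {zero}  p c d d≤0 = (λ ()) , (λ ()) , sym (n≤0⇒n≡0 d≤0)
fill {suc n} p c d d≤Σ =
  x ∷ f , capacity , trans (cong₂ _+_ (placed (p zero)) Σf) (m⊓n+n∸m≡n room d)
  where
  room x : ℕ
  room = if p zero then c zero else 0
  x    = room ⊓ d
  rest : Filling (p ∘ suc) (c ∘ suc) (d ∸ room)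
  rest = fill (p ∘ suc) (c ∘ suc) (d ∸ room) (m≤n+o⇒m∸n≤o d room d≤Σ)
  f : Fin n → ℕ
  f = proj₁ rest
  Σf : Σ⟨ p ∘ suc ⟩ f ≡ d ∸ room
  Σf = proj₂ (proj₂ rest)
  room≤c : ∀ b → (if b then c zero else 0) ≤ c zero
  room≤c true  = ≤-refl
  room≤c false = z≤n
  capacity : ∀ a → (x ∷ f) a ≤ c a
  capacity zero    = ≤-trans (m⊓n≤m room d) (room≤c (p zero))
  capacity (suc a) = proj₁ (proj₂ rest) a
  placed : ∀ b → (if b then (if b then c zero else 0) ⊓ d else 0) ≡ (if b then c zero else 0) ⊓ d
  placed true  = refl
  placed false = refl

-- Each job arc is shut down in exactly
-- one period, so over the T periods it loses exactly one period's capacity,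
-- whatever the schedule; hence every masked total capacity is invariant.

periodCap-total : ∀ N J T (τ : Fin (m N) → Fin T) a →
  Σℕ T (λ i → periodCap N J τ i a) + (if J a then cap N a else 0) ≡ T * cap N a
periodCap-total N J T τ a with J a
... | true  = Σ-hole T (τ a) (cap N a)
... | false = trans (+-identityʳ _) (Σ-const T (cap N a))

capacity-invariant : ∀ N J T (p : Fin (m N) → Bool) (τ τ′ : Fin (m N) → Fin T) →
  Σℕ T (λ i → Σ⟨ p ⟩ (periodCap N J τ i)) ≡ Σℕ T (λ i → Σ⟨ p ⟩ (periodCap N J τ′ i))
capacity-invariant N J T p τ τ′ = begin
  Σℕ T (λ i → Σ⟨ p ⟩ (periodCap N J τ i))          ≡⟨ Σ⟨⟩-swap T p _ ⟩
  Σ⟨ p ⟩ (λ a → Σℕ T (λ i → periodCap N J τ i a))  ≡⟨ Σ⟨⟩-cong p sameColumn ⟩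
  Σ⟨ p ⟩ (λ a → Σℕ T (λ i → periodCap N J τ′ i a)) ≡⟨ sym (Σ⟨⟩-swap T p _) ⟩
  Σℕ T (λ i → Σ⟨ p ⟩ (periodCap N J τ′ i))         ∎
  where
  open ≡-Reasoning
  sameColumn : ∀ a → Σℕ T (λ i → periodCap N J τ i a) ≡ Σℕ T (λ i → periodCap N J τ′ i a)
  sameColumn a = +-cancelʳ-≡ _ _ _
    (trans (periodCap-total N J T τ a) (sym (periodCap-total N J T τ′ a)))

τ₀ : ∀ {k T} → Fin k → Fin (suc T)
τ₀ _ = zero

firstPeriod : ∀ N J {T} (h : Fin (m N) → Bool) →
  Σ⟨ (λ a → h a ∧ true) ⟩ (periodCap N J {suc T} τ₀ zero) ≡ Σ⟨ (λ a → h a ∧ not (J a)) ⟩ (cap N)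
firstPeriod N J h = Σ-cong (m N) (λ a → pointwise (h a) (J a) (cap N a))
  where
  pointwise : ∀ b j (x : ℕ) →
    (if b ∧ true then (if j ∧ true then 0 else x) else 0) ≡ (if b ∧ not j then x else 0)
  pointwise true  true  x = refl
  pointwise true  false x = refl
  pointwise false j     x = refl

laterPeriod : ∀ N J {T} (h : Fin (m N) → Bool) (i : Fin T) →
  Σ⟨ (λ a → h a ∧ true) ⟩ (periodCap N J τ₀ (suc i)) ≡ Σ⟨ (λ a → h a ∧ true) ⟩ (cap N)
laterPeriod N J h i = Σ-cong (m N) (λ a → pointwise (h a) (J a) (cap N a))
  where
  pointwise : ∀ b j (x : ℕ) →
    (if b ∧ true then (if j ∧ false then 0 else x) else 0) ≡ (if b ∧ true then x else 0)
  pointwise true  true  x = refl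
  pointwise true  false x = refl
  pointwise false j     x = refl

module ThreeNode (m : ℕ) (dir : Fin m → Bool) (u : Fin m → ℕ) where

  N : Network
  N = threeNode m dir u

  In Out : (Fin m → ℕ) → ℕ
  In g  = sumIn  N (allArcs N) g vN
  Out g = sumOut N (allArcs N) g vN

  headV tailV : Fin m → Bool
  headV a = does (head N a ≟ vN)
  tailV a = does (tail N a ≟ vN)

  -- The arcs leaving s are exactly those entering v, and none enter s, so
  -- the value of a flow is its inflow into v.
  value≡In : ∀ g → value N g ≡ ℤ.+ In g
  value≡In g = begin
    ℤ.+ sumOut N (allArcs N) g sN ℤ.- ℤ.+ sumIn N (allArcs N) g sN
      ≡⟨ cong₂ (λ x y → ℤ.+ x ℤ.- ℤ.+ y) (Σ-cong m (λ a → leaveS (dir a) (g a)))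
                                       (trans (Σ-cong m (λ a → enterS (dir a) (g a))) (Σ-zero m)) ⟩
    ℤ.+ (In g + 0)
      ≡⟨ cong ℤ.+_ (+-identityʳ (In g)) ⟩
    ℤ.+ In g ∎
    where
    open ≡-Reasoning
    leaveS : ∀ b (x : ℕ) → (if does ((if b then sN else vN) ≟ sN) ∧ true then x else 0)
                         ≡ (if does ((if b then vN else tN) ≟ vN) ∧ true then x else 0)
    leaveS true  x = refl
    leaveS false x = refl
    enterS : ∀ b (x : ℕ) → (if does ((if b then vN else tN) ≟ sN) ∧ true then x else 0) ≡ 0
    enterS true  x = refl
    enterS false x = refl

  throughput≡ : ∀ T F → throughput N T F ≡ ℤ.+ Σℕ T (λ i → In (F i))
  throughput≡ zero    F = refl
  throughput≡ (suc T) F = cong₂ ℤ._+_ (value≡In (F zero)) (throughput≡ T (F ∘ suc))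

  -- Only v is subject to conservation, so a flow is an arc function within
  -- capacity whose inflow into v equals its outflow.
  isFlow : ∀ {c f} → (∀ a → f a ≤ c a) → In f ≡ Out f → IsFlow N c f
  isFlow {c} {f} f≤c balanced = record { capacity = f≤c ; conservation = conserve }
    where
    conserve : ∀ w → _ → _ → sumIn N (allArcs N) f w ≡ sumOut N (allArcs N) f w
    conserve zero             w≢s _   = ⊥-elim (w≢s refl)
    conserve (suc zero)       _   _   = balanced
    conserve (suc (suc zero)) _   w≢t = ⊥-elim (w≢t refl)

  In≤In : ∀ {c f} → IsFlow N c f → In f ≤ In c
  In≤In fl = Σ⟨⟩-mono _ (IsFlow.capacity fl)

  In≤Out : ∀ {c f} → IsFlow N c f → In f ≤ Out c
  In≤Out fl = ≤-trans (≤-reflexive (IsFlow.conservation fl vN (λ ()) (λ ())))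
                              (Σ⟨⟩-mono _ (IsFlow.capacity fl))

  -- Conversely every value d ≤ In c ⊓ Out c is attained: fill the s→v arcs
  -- and the v→t arcs separately with d units.
  flowOfValue : ∀ c d → d ≤ In c → d ≤ Out c → Σ[ f ∈ (Fin m → ℕ) ] IsFlow N c f × In f ≡ d
  flowOfValue c d d≤In d≤Out =
    f , isFlow capacity (trans In-f (sym Out-f)) , In-f
    where
    enter : Filling (λ a → headV a ∧ true) c d
    enter = fill _ c d d≤In
    leave : Filling (λ a → tailV a ∧ true) c d
    leave = fill _ c d d≤Out
    f : Fin m → ℕ
    f a = if dir a then proj₁ enter a else proj₁ leave a
    capacity : ∀ a → f a ≤ c a
    capacity a with dir a
    ... | true  = proj₁ (proj₂ enter) a
    ... | false = proj₁ (proj₂ leave) a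
    In-f : In f ≡ d
    In-f = trans (Σ-cong m entering) (proj₂ (proj₂ enter))
      where
      entering : ∀ a → (if does (head N a ≟ vN) ∧ true then f a else 0)
                     ≡ (if does (head N a ≟ vN) ∧ true then proj₁ enter a else 0)
      entering a with dir a
      ... | true  = refl
      ... | false = refl
    Out-f : Out f ≡ d
    Out-f = trans (Σ-cong m leaving) (proj₂ (proj₂ leave))
      where
      leaving : ∀ a → (if does (tail N a ≟ vN) ∧ true then f a else 0)
                    ≡ (if does (tail N a ≟ vN) ∧ true then proj₁ leave a else 0)
      leaving a with dir a
      ... | true  = refl
      ... | false = refl

  module AllJobsFirst (J : Fin m → Bool) (T : ℕ) where

    c₀ : Fin (suc T) → Fin m → ℕ
    c₀ = periodCap N J τ₀

    everyPeriod : (R : ℕ → ℕ → Set) → R (C₂⁻ N J vN) (C₂⁺ N J vN) → R (C₁⁻ N vN) (C₁⁺ N vN) →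
                  ∀ i → R (In (c₀ i)) (Out (c₀ i))
    everyPeriod R r₂ r₁ zero    =
      subst₂ R (sym (firstPeriod N J {T} headV)) (sym (firstPeriod N J {T} tailV)) r₂
    everyPeriod R r₂ r₁ (suc i) =
      subst₂ R (sym (laterPeriod N J headV i)) (sym (laterPeriod N J tailV i)) r₁

    best : Fin (suc T) → ℕ
    best i = In (c₀ i) ⊓ Out (c₀ i)

    bestFlow : ∀ i → Σ[ f ∈ (Fin m → ℕ) ] IsFlow N (c₀ i) f × In f ≡ best i
    bestFlow i = flowOfValue (c₀ i) (best i) (m⊓n≤m _ _) (m⊓n≤n _ _)

    F₀ : Fin (suc T) → Fin m → ℕ
    F₀ i = proj₁ (bestFlow i)

    F₀-feasible : Feasible N J (suc T) τ₀ F₀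
    F₀-feasible i = proj₁ (proj₂ (bestFlow i))

    F₀-value : ∀ i → In (F₀ i) ≡ best i
    F₀-value i = proj₂ (proj₂ (bestFlow i))

    -- Any schedule with feasible flows is bounded by the smaller of the two
    -- total cut capacities, which do not depend on the schedule.
    totalBound : ∀ τ F → Feasible N J (suc T) τ F →
      Σℕ (suc T) (λ i → In (F i)) ≤ Σℕ (suc T) (In ∘ c₀) ⊓ Σℕ (suc T) (Out ∘ c₀)
    totalBound τ F feasible = ⊓-glb
      (≤-trans (Σ-mono (suc T) (In≤In ∘ feasible))
               (≤-reflexive (capacity-invariant N J (suc T) (λ a → headV a ∧ true) τ τ₀)))
      (≤-trans (Σ-mono (suc T) (In≤Out ∘ feasible))
               (≤-reflexive (capacity-invariant N J (suc T) (λ a → tailV a ∧ true) τ τ₀)))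

proposition1 : (m : ℕ) (dir : Fin m → Bool) (u : Fin m → ℕ) (J : Fin m → Bool) (T : ℕ) →
    1 ≤ T →
    ((C₁⁻ (threeNode m dir u) vN ≤ C₁⁺ (threeNode m dir u) vN ×
      C₂⁻ (threeNode m dir u) J vN ≤ C₂⁺ (threeNode m dir u) J vN)
     ⊎
     (C₁⁺ (threeNode m dir u) vN ≤ C₁⁻ (threeNode m dir u) vN ×
      C₂⁺ (threeNode m dir u) J vN ≤ C₂⁻ (threeNode m dir u) J vN)) →
    SamePeriodOptimal (threeNode m dir u) J T
proposition1 m dir u J (suc T) (s≤s z≤n) hyp = zero , F₀ , F₀-feasible , optimal
  where
  open ThreeNode m dir u
  open AllJobsFirst J T
  -- (i) or (ii) says the same side of v is the bottleneck in every period.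
  sameBottleneck : (∀ i → In (c₀ i) ≤ Out (c₀ i)) ⊎ (∀ i → Out (c₀ i) ≤ In (c₀ i))
  sameBottleneck = map-⊎
    (λ { (C₁⁻≤C₁⁺ , C₂⁻≤C₂⁺) → everyPeriod _≤_ C₂⁻≤C₂⁺ C₁⁻≤C₁⁺ })
    (λ { (C₁⁺≤C₁⁻ , C₂⁺≤C₂⁻) → everyPeriod (λ x y → y ≤ x) C₂⁺≤C₂⁻ C₁⁺≤C₁⁻ })
    hyp
  optimal : ∀ τ F → Feasible N J (suc T) τ F → throughput N (suc T) F ℤ.≤ throughput N (suc T) F₀
  optimal τ F feasible = subst₂ ℤ._≤_ (sym (throughput≡ (suc T) F)) (sym (throughput≡ (suc T) F₀))
    (+≤+ (begin
      Σℕ (suc T) (λ i → In (F i))                         ≤⟨ totalBound τ F feasible ⟩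
      Σℕ (suc T) (In ∘ c₀) ⊓ Σℕ (suc T) (Out ∘ c₀)       ≡⟨ sym (Σ-⊓ (suc T) _ _ sameBottleneck) ⟩
      Σℕ (suc T) best                                     ≡⟨ sym (Σ-cong (suc T) F₀-value) ⟩
      Σℕ (suc T) (λ i → In (F₀ i))                        ∎))
    where open ≤-Reasoning
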